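{- For every integer $n>1$, $$\binom{1,\,n-1}{1,\,3}=\sum_{X\subseteq Y\subseteq [n]}\big(|Y|-|X|\big),$$ where the sum runs over all pairs of subsets $X\subseteq Y$ of $[n]=\{1,\dots,n\}$.
   Context: For a nonnegative integer $m$ and positive integers $n,q$, let $Z$ be a set which is the disjoint union of $n$ "main blocks" each of size $q$ and an "additional block" of size $m$. An $(n+k)$-inset of $Z$ is an $(n+k)$-element subset of $Z$ that intersects every main block; their number is denoted $\binom{m,n}{k,q}$. Thus $\binom{1,n-1}{1,3}$ counts $n$-subsets of the union of $n-1$ three-element main blocks and a one-element additional block that meet every main block. -}

module Defs where

open import Data.Nat using (ℕ; zero; suc; _+_; _*_)
open import Data.Fin using (Fin; splitAt; remQuot; combine; join)
open import Data.Fin.Subset using (Subset; _∈_; _⊆_; ∣_∣; inside; outside)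
open import Data.Fin.Subset.Properties using (_∈?_; _⊆?_)
open import Data.Fin.Properties using (all?; any?)
open import Data.Vec using ([]; _∷_)
open import Data.List using (List; []; _∷_; map; _++_; filter; length; concatMap)
open import Data.Nat.ListAction using (sum)
open import Data.Sum using (inj₂)
open import Data.Product using (∃; _×_; _,_; proj₁; proj₂)
open import Relation.Nullary using (Dec)
open import Relation.Nullary.Decidable using (_×-dec_)
open import Relation.Binary.PropositionalEquality using (_≡_)
import Data.Nat.Properties as ℕP

allSubsets : (N : ℕ) → List (Subset N)
allSubsets zero = [] ∷ []
allSubsets (suc N) =
  map (outside ∷_) (allSubsets N) ++ map (inside ∷_) (allSubsets N)

-- The first m elements (splitAt m z = inj₁ _)
-- form the additional block of size m; the element
--   mainElem b r = join m (n * q) (inj₂ (combine b r))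
-- is the r-th element (r : Fin q) of the main block b (b : Fin n).
-- Main blocks are pairwise disjoint, of size q each, and disjoint from
-- the additional block; together they cover Z.
mainElem : ∀ m {n q} → Fin n → Fin q → Fin (m + n * q)
mainElem m {n} {q} b r = join m (n * q) (inj₂ (combine b r))

MeetsBlock : ∀ m {n q} → Subset (m + n * q) → Fin n → Set
MeetsBlock m {n} {q} S b = ∃ λ (r : Fin q) → mainElem m b r ∈ S

IsInset : ∀ m n k q → Subset (m + n * q) → Set
IsInset m n k q S = (∣ S ∣ ≡ n + k) × (∀ b → MeetsBlock m {n} {q} S b)

isInset? : ∀ m n k q (S : Subset (m + n * q)) → Dec (IsInset m n k q S)
isInset? m n k q S =
  (∣ S ∣ ℕP.≟ (n + k)) ×-dec all? (λ (b : Fin n) → any? (λ (r : Fin q) → mainElem m b r ∈? S))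

-- The number  binom(m,n ; k,q)  of (n+k)-insets of Z.
insetCount : (m n k q : ℕ) → ℕ
insetCount m n k q = length (filter (isInset? m n k q) (allSubsets (m + n * q)))

-- Σ_{X ⊆ Y ⊆ [n]} (|Y| - |X|)   (note |X| ≤ |Y| so truncated minus is exact,
-- written here as the sum over pairs of the natural number |Y| ∸ |X|)
open import Data.Nat using (_∸_)

chainSum : ℕ → ℕ
chainSum n =
  sum (concatMap (λ Y →
        map (λ X → ∣ Y ∣ ∸ ∣ X ∣) (filter (λ X → X ⊆? Y) (allSubsets n)))
      (allSubsets n))

-- Write n = k + 1.  An n-inset of k three-element blocks plus one extra point either
-- contains the extra point, and then takes exactly one element of every block
-- (3^k choices), or avoids it, and then takes two elements of one block and one of
-- every other block (k · 3^k choices); in total (k + 1) · 3^k.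
-- A pair X ⊆ Y ⊆ [n] is a colouring of [n] by {∉ Y, ∈ Y ∖ X, ∈ X}, so there are 3^n
-- of them, and splitting off the first point gives the recurrence
-- C (n + 1) = 3 C n + 3^n for C n = Σ (|Y| − |X|), whence C (k + 1) = (k + 1) · 3^k.
module Submission where

open import Defs
open import Data.Bool using (Bool; true; false; if_then_else_; _∧_; _∨_; T)
open import Data.Bool.Properties using (∧-comm; T-∧)
open import Data.Fin using (Fin; zero; suc; combine)
open import Data.Fin.Subset using (Subset; ∣_∣; _∈_; inside; outside)
open import Data.Fin.Subset.Properties using (_⊆?_; _∈?_; drop-there; p⊆q⇒∣p∣≤∣q∣)
open import Data.Fin.Properties using (all?; any?)
open import Data.List using (List; []; _∷_; map; _++_; filter; length; concatMap)
open import Data.List.Properties using (map-++; map-∘; map-cong)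
open import Data.Nat using (ℕ; zero; suc; _+_; _*_; _∸_; _^_; _<_; _≤_; z≤n; s≤s)
open import Data.Nat.ListAction using (sum)
open import Data.Nat.ListAction.Properties using (sum-++)
open import Data.Nat.Properties
open import Data.Nat.Tactic.RingSolver using (solve-∀)
open import Data.Product using (∃; _,_; proj₁; proj₂)
open import Data.Unit using (tt)
open import Data.Vec using (here; there) renaming ([] to []ᵛ; _∷_ to _∷ᵛ_; _++_ to _++ᵛ_)
open import Function using (_∘′_)
open import Function.Bundles using (Equivalence)
open import Relation.Nullary using (yes; no; does; proof)
open import Relation.Nullary.Decidable using (dec-true; dec-false)
open import Relation.Nullary.Reflects using (det; fromEquivalence)
open import Relation.Unary using (Pred; Decidable)
open import Relation.Binary.PropositionalEquality
open ≡-Reasoning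

𝟙 : Bool → ℕ
𝟙 b = if b then 1 else 0

module _ {A : Set} where

  sum-map-+ : (f g : A → ℕ) (xs : List A) →
              sum (map (λ x → f x + g x) xs) ≡ sum (map f xs) + sum (map g xs)
  sum-map-+ f g [] = refl
  sum-map-+ f g (x ∷ xs) =
    trans (cong (f x + g x +_) (sum-map-+ f g xs))
          (+-interchange (f x) (g x) (sum (map f xs)) (sum (map g xs)))
    where
    +-interchange : ∀ a b c d → (a + b) + (c + d) ≡ (a + c) + (b + d)
    +-interchange = solve-∀

  sum-map-0 : (xs : List A) → sum (map (λ _ → 0) xs) ≡ 0
  sum-map-0 [] = refl
  sum-map-0 (x ∷ xs) = sum-map-0 xs

  sum-map-cong : {f g : A → ℕ} → (∀ x → f x ≡ g x) → (xs : List A) →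
                 sum (map f xs) ≡ sum (map g xs)
  sum-map-cong f≗g xs = cong sum (map-cong f≗g xs)

  sum-map-filter : ∀ {ℓ} {P : Pred A ℓ} (P? : Decidable P) (h : A → ℕ) (xs : List A) →
                   sum (map h (filter P? xs)) ≡ sum (map (λ x → if does (P? x) then h x else 0) xs)
  sum-map-filter P? h [] = refl
  sum-map-filter P? h (x ∷ xs) with does (P? x)
  ... | true = cong (h x +_) (sum-map-filter P? h xs)
  ... | false = sum-map-filter P? h xs

  length-filter≡sum-𝟙 : ∀ {ℓ} {P : Pred A ℓ} (P? : Decidable P) (xs : List A) →
                        length (filter P? xs) ≡ sum (map (λ x → 𝟙 (does (P? x))) xs)
  length-filter≡sum-𝟙 P? [] = refl
  length-filter≡sum-𝟙 P? (x ∷ xs) with does (P? x)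
  ... | true = cong suc (length-filter≡sum-𝟙 P? xs)
  ... | false = length-filter≡sum-𝟙 P? xs

  sum-concatMap : (f : A → List ℕ) (xs : List A) →
                  sum (concatMap f xs) ≡ sum (map (λ x → sum (f x)) xs)
  sum-concatMap f [] = refl
  sum-concatMap f (x ∷ xs) =
    trans (sum-++ (f x) (concatMap f xs)) (cong (sum (f x) +_) (sum-concatMap f xs))

sumBool : (Bool → ℕ) → ℕ
sumBool f = f false + f true

sumBool-cong : {f g : Bool → ℕ} → (∀ a → f a ≡ g a) → sumBool f ≡ sumBool g
sumBool-cong f≗g = cong₂ _+_ (f≗g false) (f≗g true)

sumSubsets : (n : ℕ) → (Subset n → ℕ) → ℕ
sumSubsets n f = sum (map f (allSubsets n))

module _ (n : ℕ) where

  sumSubsets-cong : {f g : Subset n → ℕ} → (∀ S → f S ≡ g S) → sumSubsets n f ≡ sumSubsets n g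
  sumSubsets-cong f≗g = sum-map-cong f≗g (allSubsets n)

  sumSubsets-+ : (f g : Subset n → ℕ) →
                 sumSubsets n (λ S → f S + g S) ≡ sumSubsets n f + sumSubsets n g
  sumSubsets-+ f g = sum-map-+ f g (allSubsets n)

  sumSubsets-0 : sumSubsets n (λ _ → 0) ≡ 0
  sumSubsets-0 = sum-map-0 (allSubsets n)

  sumSubsets-suc : (f : Subset (suc n) → ℕ) →
                   sumSubsets (suc n) f ≡ sumBool (λ a → sumSubsets n (λ S → f (a ∷ᵛ S)))
  sumSubsets-suc f = begin
    sum (map f (map (outside ∷ᵛ_) Ss ++ map (inside ∷ᵛ_) Ss))
      ≡⟨ cong sum (map-++ f (map (outside ∷ᵛ_) Ss) (map (inside ∷ᵛ_) Ss)) ⟩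
    sum (map f (map (outside ∷ᵛ_) Ss) ++ map f (map (inside ∷ᵛ_) Ss))
      ≡⟨ sum-++ (map f (map (outside ∷ᵛ_) Ss)) _ ⟩
    sum (map f (map (outside ∷ᵛ_) Ss)) + sum (map f (map (inside ∷ᵛ_) Ss))
      ≡⟨ cong₂ _+_ (cong sum (map-∘ Ss)) (cong sum (map-∘ Ss)) ⟨
    sumBool (λ a → sumSubsets n (λ S → f (a ∷ᵛ S))) ∎
    where Ss = allSubsets n

  sumSubsets-sumBool : (f : Bool → Subset n → ℕ) →
                       sumSubsets n (λ S → sumBool (λ a → f a S)) ≡ sumBool (λ a → sumSubsets n (f a))
  sumSubsets-sumBool f = sumSubsets-+ (f false) (f true)

sumSubsets-suc³ : ∀ n (f : Subset (3 + n) → ℕ) →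
  sumSubsets (3 + n) f ≡
    sumBool (λ a → sumBool (λ b → sumBool (λ c → sumSubsets n (λ S → f (a ∷ᵛ b ∷ᵛ c ∷ᵛ S)))))
sumSubsets-suc³ n f =
  trans (sumSubsets-suc (2 + n) f) (sumBool-cong λ a →
  trans (sumSubsets-suc (1 + n) (λ S → f (a ∷ᵛ S))) (sumBool-cong λ b →
  sumSubsets-suc n (λ S → f (a ∷ᵛ b ∷ᵛ S))))

sumPairs : (n : ℕ) → (Subset n → Subset n → ℕ) → ℕ
sumPairs n h = sumSubsets n (λ Y → sumSubsets n (h Y))

module _ (n : ℕ) where

  sumPairs-cong : {f g : Subset n → Subset n → ℕ} → (∀ Y X → f Y X ≡ g Y X) →
                  sumPairs n f ≡ sumPairs n g
  sumPairs-cong f≗g = sumSubsets-cong n (λ Y → sumSubsets-cong n (f≗g Y))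

  sumPairs-+ : (f g : Subset n → Subset n → ℕ) →
               sumPairs n (λ Y X → f Y X + g Y X) ≡ sumPairs n f + sumPairs n g
  sumPairs-+ f g = trans (sumSubsets-cong n (λ Y → sumSubsets-+ n (f Y) (g Y))) (sumSubsets-+ n _ _)

  sumPairs-0 : sumPairs n (λ _ _ → 0) ≡ 0
  sumPairs-0 = trans (sumSubsets-cong n (λ _ → sumSubsets-0 n)) (sumSubsets-0 n)

  sumPairs-suc : (h : Subset (suc n) → Subset (suc n) → ℕ) →
    sumPairs (suc n) h ≡ sumBool (λ a → sumBool (λ b → sumPairs n (λ Y X → h (a ∷ᵛ Y) (b ∷ᵛ X))))
  sumPairs-suc h = trans (sumSubsets-suc n _) (sumBool-cong λ a →
    trans (sumSubsets-cong n (λ Y → sumSubsets-suc n (h (a ∷ᵛ Y))))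
          (sumSubsets-sumBool n (λ b Y → sumSubsets n (λ X → h (a ∷ᵛ Y) (b ∷ᵛ X)))))

∣p++q∣≡∣p∣+∣q∣ : ∀ {m n} (p : Subset m) (q : Subset n) → ∣ p ++ᵛ q ∣ ≡ ∣ p ∣ + ∣ q ∣
∣p++q∣≡∣p∣+∣q∣ []ᵛ q = refl
∣p++q∣≡∣p∣+∣q∣ (outside ∷ᵛ p) q = ∣p++q∣≡∣p∣+∣q∣ p q
∣p++q∣≡∣p∣+∣q∣ (inside ∷ᵛ p) q = cong suc (∣p++q∣≡∣p∣+∣q∣ p q)

chainIndicator : ∀ {n} → Subset n → Subset n → ℕ
chainIndicator Y X = 𝟙 (does (X ⊆? Y))

chainGap : ∀ {n} → Subset n → Subset n → ℕ
chainGap Y X = if does (X ⊆? Y) then ∣ Y ∣ ∸ ∣ X ∣ else 0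

chainSum≡sumPairs-chainGap : ∀ n → chainSum n ≡ sumPairs n chainGap
chainSum≡sumPairs-chainGap n =
  trans (sum-concatMap _ (allSubsets n))
        (sum-map-cong (λ Y → sum-map-filter (_⊆? Y) (λ X → ∣ Y ∣ ∸ ∣ X ∣) (allSubsets n))
                      (allSubsets n))

chainGap-∷-inside-outside : ∀ {n} (Y X : Subset n) →
  chainGap (inside ∷ᵛ Y) (outside ∷ᵛ X) ≡ chainGap Y X + chainIndicator Y X
chainGap-∷-inside-outside Y X with X ⊆? Y
... | yes X⊆Y = trans (+-∸-assoc 1 (p⊆q⇒∣p∣≤∣q∣ X⊆Y)) (+-comm 1 _)
... | no _ = refl

sumPairs-chainIndicator : ∀ n → sumPairs n chainIndicator ≡ 3 ^ n
sumPairs-chainIndicator zero = refl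
sumPairs-chainIndicator (suc n) = begin
  sumPairs (suc n) chainIndicator                          ≡⟨ sumPairs-suc n chainIndicator ⟩
  (C + sumPairs n (λ _ _ → 0)) + (C + C)                   ≡⟨ cong (λ z → (C + z) + (C + C)) (sumPairs-0 n) ⟩
  (C + 0) + (C + C)                                        ≡⟨ cong (λ z → (z + 0) + (z + z)) (sumPairs-chainIndicator n) ⟩
  (3 ^ n + 0) + (3 ^ n + 3 ^ n)                             ≡⟨ x+0+[x+x]≡3x (3 ^ n) ⟩
  3 ^ suc n                                                ∎
  where
  C = sumPairs n chainIndicator
  x+0+[x+x]≡3x : ∀ x → (x + 0) + (x + x) ≡ 3 * x
  x+0+[x+x]≡3x = solve-∀

sumPairs-chainGap-suc : ∀ n →
  sumPairs (suc n) chainGap ≡ 3 * sumPairs n chainGap + sumPairs n chainIndicator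
sumPairs-chainGap-suc n = begin
  sumPairs (suc n) chainGap
    ≡⟨ sumPairs-suc n chainGap ⟩
  (G + sumPairs n (λ _ _ → 0)) + (sumPairs n (λ Y X → chainGap (inside ∷ᵛ Y) (outside ∷ᵛ X)) + G)
    ≡⟨ cong₂ (λ z w → (G + z) + (w + G)) (sumPairs-0 n)
             (trans (sumPairs-cong n chainGap-∷-inside-outside) (sumPairs-+ n chainGap chainIndicator)) ⟩
  (G + 0) + ((G + C) + G)
    ≡⟨ rearrange G C ⟩
  3 * G + C ∎
  where
  G = sumPairs n chainGap
  C = sumPairs n chainIndicator
  rearrange : ∀ g c → (g + 0) + ((g + c) + g) ≡ 3 * g + c
  rearrange = solve-∀

sumPairs-chainGap : ∀ k → sumPairs (suc k) chainGap ≡ suc k * 3 ^ k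
sumPairs-chainGap zero = refl
sumPairs-chainGap (suc k) = begin
  sumPairs (suc (suc k)) chainGap
    ≡⟨ sumPairs-chainGap-suc (suc k) ⟩
  3 * sumPairs (suc k) chainGap + sumPairs (suc k) chainIndicator
    ≡⟨ cong₂ (λ g c → 3 * g + c) (sumPairs-chainGap k) (sumPairs-chainIndicator (suc k)) ⟩
  3 * (suc k * 3 ^ k) + 3 ^ suc k
    ≡⟨ arithmetic k (3 ^ k) ⟩
  suc (suc k) * 3 ^ suc k ∎
  where
  arithmetic : ∀ k p → 3 * ((1 + k) * p) + 3 * p ≡ (2 + k) * (3 * p)
  arithmetic = solve-∀

chainSum-suc : ∀ k → chainSum (suc k) ≡ suc k * 3 ^ k
chainSum-suc k = trans (chainSum≡sumPairs-chainGap (suc k)) (sumPairs-chainGap k)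

MeetsEveryTriple : ∀ k → Subset (k * 3) → Set
MeetsEveryTriple k S = ∀ (b : Fin k) → ∃ λ (r : Fin 3) → combine b r ∈ S

meetsEveryTriple : ∀ k → Subset (k * 3) → Bool
meetsEveryTriple zero []ᵛ = true
meetsEveryTriple (suc k) (x ∷ᵛ y ∷ᵛ z ∷ᵛ S) = (x ∨ y ∨ z) ∧ meetsEveryTriple k S

∈-first-triple⇒∨ : ∀ {k} x y z (S : Subset (k * 3)) (r : Fin 3) →
                   combine {suc k} zero r ∈ (x ∷ᵛ y ∷ᵛ z ∷ᵛ S) → T (x ∨ y ∨ z)
∈-first-triple⇒∨ inside _ _ _ _ _ = tt
∈-first-triple⇒∨ outside inside _ _ _ _ = tt
∈-first-triple⇒∨ outside outside inside _ _ _ = tt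
∈-first-triple⇒∨ outside outside outside _ zero ()
∈-first-triple⇒∨ outside outside outside _ (suc zero) (there ())
∈-first-triple⇒∨ outside outside outside _ (suc (suc zero)) (there (there ()))

meetsEveryTriple-complete : ∀ k S → MeetsEveryTriple k S → T (meetsEveryTriple k S)
meetsEveryTriple-complete zero []ᵛ _ = tt
meetsEveryTriple-complete (suc k) (x ∷ᵛ y ∷ᵛ z ∷ᵛ S) meets = Equivalence.from T-∧
  ( ∈-first-triple⇒∨ {k} x y z S (proj₁ (meets zero)) (proj₂ (meets zero))
  , meetsEveryTriple-complete k S (λ b → proj₁ (meets (suc b)) , drop-there³ (proj₂ (meets (suc b)))))
  where
  drop-there³ : ∀ {i} → suc (suc (suc i)) ∈ (x ∷ᵛ y ∷ᵛ z ∷ᵛ S) → i ∈ S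
  drop-there³ = drop-there ∘′ drop-there ∘′ drop-there

meetsEveryTriple-sound : ∀ k S → T (meetsEveryTriple k S) → MeetsEveryTriple k S
meetsEveryTriple-sound (suc k) (inside ∷ᵛ _ ∷ᵛ _ ∷ᵛ _) _ zero = zero , here
meetsEveryTriple-sound (suc k) (outside ∷ᵛ inside ∷ᵛ _ ∷ᵛ _) _ zero = suc zero , there here
meetsEveryTriple-sound (suc k) (outside ∷ᵛ outside ∷ᵛ inside ∷ᵛ _) _ zero =
  suc (suc zero) , there (there here)
meetsEveryTriple-sound (suc k) (x ∷ᵛ y ∷ᵛ z ∷ᵛ S) meets (suc b) =
  let r , r∈S = meetsEveryTriple-sound k S (proj₂ (Equivalence.to T-∧ meets)) b
  in r , there (there (there r∈S))

-- mainElem 1 b r reduces to suc (combine b r): the additional block is the first point.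
does-meetsBlocks≡meetsEveryTriple : ∀ k a (S : Subset (k * 3)) →
  does (all? (λ (b : Fin k) → any? (λ (r : Fin 3) → mainElem 1 b r ∈? (a ∷ᵛ S))))
    ≡ meetsEveryTriple k S
does-meetsBlocks≡meetsEveryTriple k a S = det (proof (all? _)) (fromEquivalence
  (λ meets b → let r , r∈S = meetsEveryTriple-sound k S meets b in r , there r∈S)
  (λ meets → meetsEveryTriple-complete k S (λ b → proj₁ (meets b) , drop-there (proj₂ (meets b)))))

-- The offset t counts the points chosen in triples already split off, so sizes are never
-- subtracted.
coverCount : (k t s : ℕ) → ℕ
coverCount k t s = sumSubsets (k * 3) (λ S → 𝟙 (meetsEveryTriple k S ∧ does (t + ∣ S ∣ ≟ s)))

coverCount-first-triple : ∀ k t s (a b c : Bool) →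
  sumSubsets (k * 3)
    (λ S → 𝟙 ((a ∨ b ∨ c) ∧ meetsEveryTriple k S ∧ does (t + ∣ a ∷ᵛ b ∷ᵛ c ∷ᵛ S ∣ ≟ s)))
    ≡ (if a ∨ b ∨ c then coverCount k (t + ∣ a ∷ᵛ b ∷ᵛ c ∷ᵛ []ᵛ ∣) s else 0)
coverCount-first-triple k t s a b c with a ∨ b ∨ c
... | false = sumSubsets-0 (k * 3)
... | true = sumSubsets-cong (k * 3) λ S →
  cong (λ m → 𝟙 (meetsEveryTriple k S ∧ does (m ≟ s))) (begin
    t + ∣ (a ∷ᵛ b ∷ᵛ c ∷ᵛ []ᵛ) ++ᵛ S ∣       ≡⟨ cong (t +_) (∣p++q∣≡∣p∣+∣q∣ (a ∷ᵛ b ∷ᵛ c ∷ᵛ []ᵛ) S) ⟩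
    t + (∣ a ∷ᵛ b ∷ᵛ c ∷ᵛ []ᵛ ∣ + ∣ S ∣)     ≡⟨ +-assoc t _ _ ⟨
    t + ∣ a ∷ᵛ b ∷ᵛ c ∷ᵛ []ᵛ ∣ + ∣ S ∣       ∎)

coverCount-suc : ∀ k t s →
  coverCount (suc k) t s ≡ 3 * coverCount k (t + 1) s + 3 * coverCount k (t + 2) s + coverCount k (t + 3) s
coverCount-suc k t s =
  trans (sumSubsets-suc³ (k * 3) _)
  (trans (sumBool-cong λ a → sumBool-cong λ b → sumBool-cong λ c → coverCount-first-triple k t s a b c)
         (collect (coverCount k (t + 1) s) (coverCount k (t + 2) s) (coverCount k (t + 3) s)))
  where
  collect : ∀ c₁ c₂ c₃ → (0 + c₁ + (c₁ + c₂)) + ((c₁ + c₂) + (c₂ + c₃)) ≡ 3 * c₁ + 3 * c₂ + c₃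
  collect = solve-∀

offset-mono : ∀ t k {u w} → u ≤ w → t + (u + k) ≤ t + w + k
offset-mono t k {w = w} u≤w = ≤-trans (+-monoʳ-≤ t (+-monoˡ-≤ k u≤w)) (≤-reflexive (sym (+-assoc t w k)))

offset-< : ∀ {s} t k {u w} → s ≡ t + (u + k) → u < w → s < t + w + k
offset-< t k {u} refl u<w = ≤-trans (≤-reflexive (sym (+-suc t (u + k)))) (offset-mono t k u<w)

coverCount-below : ∀ k t s → s < t + k → coverCount k t s ≡ 0
coverCount-below zero t s s<t+0 =
  cong (λ b → 𝟙 b + 0) (dec-false (t + 0 ≟ s) (λ t+0≡s → <-irrefl (sym t+0≡s) s<t+0))
coverCount-below (suc k) t s s<t+1+k
  rewrite coverCount-suc k t s
        | coverCount-below k (t + 1) s (<-≤-trans s<t+1+k (offset-mono t k (s≤s z≤n)))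
        | coverCount-below k (t + 2) s (<-≤-trans s<t+1+k (offset-mono t k (s≤s z≤n)))
        | coverCount-below k (t + 3) s (<-≤-trans s<t+1+k (offset-mono t k (s≤s z≤n))) = refl

coverCount-exact : ∀ k t s → s ≡ t + k → coverCount k t s ≡ 3 ^ k
coverCount-exact zero t s s≡t+0 = cong (λ b → 𝟙 b + 0) (dec-true (t + 0 ≟ s) (sym s≡t+0))
coverCount-exact (suc k) t s s≡t+1+k
  rewrite coverCount-suc k t s
        | coverCount-exact k (t + 1) s (trans s≡t+1+k (sym (+-assoc t 1 k)))
        | coverCount-below k (t + 2) s (offset-< t k s≡t+1+k ≤-refl)
        | coverCount-below k (t + 3) s (offset-< t k s≡t+1+k (s≤s (s≤s z≤n))) =
  trans (+-identityʳ _) (+-identityʳ _)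

coverCount-one-more : ∀ k t s → s ≡ t + suc k → coverCount k t s ≡ k * 3 ^ k
coverCount-one-more zero t s s≡t+1 =
  cong (λ b → 𝟙 b + 0) (dec-false (t + 0 ≟ s) (λ t+0≡s → <-irrefl (trans t+0≡s s≡t+1) (+-monoʳ-< t (s≤s z≤n))))
coverCount-one-more (suc k) t s s≡t+2+k
  rewrite coverCount-suc k t s
        | coverCount-one-more k (t + 1) s (trans s≡t+2+k (sym (+-assoc t 1 (suc k))))
        | coverCount-exact k (t + 2) s (trans s≡t+2+k (sym (+-assoc t 2 k)))
        | coverCount-below k (t + 3) s (offset-< t k s≡t+2+k ≤-refl) = arithmetic k (3 ^ k)
  where
  arithmetic : ∀ k p → 3 * (k * p) + 3 * p + 0 ≡ (1 + k) * (3 * p)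
  arithmetic = solve-∀

insetCount≡coverCounts : ∀ k → insetCount 1 k 1 3 ≡ coverCount k 0 (k + 1) + coverCount k 1 (k + 1)
insetCount≡coverCounts k =
  trans (length-filter≡sum-𝟙 (isInset? 1 k 1 3) (allSubsets (suc (k * 3))))
  (trans (sumSubsets-suc (k * 3) _)
         (sumBool-cong λ a → sumSubsets-cong (k * 3) λ S →
            cong 𝟙 (trans (cong (does (∣ a ∷ᵛ S ∣ ≟ k + 1) ∧_) (does-meetsBlocks≡meetsEveryTriple k a S))
                          (∧-comm (does (∣ a ∷ᵛ S ∣ ≟ k + 1)) (meetsEveryTriple k S)))))

mainTheorem19 : (n : ℕ) → 1 < n → insetCount 1 (n ∸ 1) 1 3 ≡ chainSum n
mainTheorem19 (suc k) _ = begin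
  insetCount 1 k 1 3                           ≡⟨ insetCount≡coverCounts k ⟩
  coverCount k 0 (k + 1) + coverCount k 1 (k + 1)
    ≡⟨ cong₂ _+_ (coverCount-one-more k 0 (k + 1) (+-comm k 1)) (coverCount-exact k 1 (k + 1) (+-comm k 1)) ⟩
  k * 3 ^ k + 3 ^ k                            ≡⟨ +-comm (k * 3 ^ k) (3 ^ k) ⟩
  suc k * 3 ^ k                                ≡⟨ chainSum-suc k ⟨
  chainSum (suc k)                             ∎
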